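{- Let $\pi\in\mathrm{Av}(231)$ be a permutation of $[n]$. Let $x,y\in[n]$ with $x<y$, and suppose that no value larger than $y$ occurs between $x$ and $y$ in $\pi$. Then $\lambda_\pi(x)<\lambda_\pi(y)$.
   Context: Notation and conventions. - Permutations are in one-line notation, with composition $(\lambda\circ\sigma)(i)=\lambda(\sigma(i))$. - "Between $x$ and $y$" refers to positions strictly between those of $x$ and $y$. - $\mathrm{Av}(231)$ (resp. $\mathrm{Av}(132)$) is the set of permutations avoiding $231$ (resp. $132$). The bijection $P$. - $\alpha\oplus\beta=\alpha(\beta+|\alpha|)$ and $\alpha\ominus\beta=(\alpha+|\beta|)\beta$. - Every nonempty $\pi\in\mathrm{Av}(231)$ is uniquely $\alpha\oplus(1\ominus\beta)$ with $\alpha,\beta\in\mathrm{Av}(231)$, possibly empty. - $P:\mathrm{Av}(231)\to\mathrm{Av}(132)$ is defined by $P(\varepsilon)=\varepsilon$ and $P(\alpha\oplus(1\ominus\beta))=(P(\alpha)\oplus1)\ominus P(\beta)$. - $\lambda_\pi$ is the permutation of $[n]$ with $P(\pi)=\lambda_\pi\circ\pi$. -}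

module Defs where

open import Data.Nat using (ℕ; zero; suc; _+_; _∸_; _<_; _≤_; _≟_)
open import Data.List using (List; []; _∷_; _++_; map; length; upTo; span; drop)
open import Data.List.Relation.Binary.Permutation.Propositional using (_↭_)
open import Data.Product using (_×_; proj₁; proj₂)
open import Data.Sum using (_⊎_)
open import Relation.Nullary using (¬_)
open import Relation.Nullary.Decidable using (¬?; does)
open import Data.Bool using (if_then_else_)

-- Permutations are lists in one-line notation with values 1..n.
-- [1..n]
oneTo : ℕ → List ℕ
oneTo n = map suc (upTo n)

IsPerm : ℕ → List ℕ → Set
IsPerm n π = π ↭ oneTo n

-- 0-based access with default 0 (only used at valid positions)
at : List ℕ → ℕ → ℕ
at []       _       = 0
at (v ∷ vs) zero    = v
at (v ∷ vs) (suc i) = at vs i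

-- 0-based position of the first occurrence of x (length of list if absent)
indexOf : ℕ → List ℕ → ℕ
indexOf x []       = 0
indexOf x (v ∷ vs) = if does (x ≟ v) then 0 else suc (indexOf x vs)

Contains231 : List ℕ → Set
Contains231 π = Σ3
  where
  Σ3 : Set
  Σ3 = Data.Product.∃ λ i → Data.Product.∃ λ j → Data.Product.∃ λ k →
         (i < j) × (j < k) × (k < length π) ×
         (at π k < at π i) × (at π i < at π j)

Avoids231 : List ℕ → Set
Avoids231 π = ¬ Contains231 π

-- The bijection P : Av(231) → Av(132).
-- For nonempty π ∈ Av(231) of length n, π = α ⊕ (1 ⊖ β): the value n sits
-- right after the prefix α, and the suffix after n is β shifted up by |α|.
-- P(π) = (P(α) ⊕ 1) ⊖ P(β) = (P(α) + |β|) , (|α| + 1 + |β|) , P(β).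
-- Recursion is on a fuel argument (≥ length suffices).
Pf : ℕ → List ℕ → List ℕ
Pf zero     _  = []
Pf (suc f)  [] = []
Pf (suc f)  π@(_ ∷ _) =
  let n  = length π
      sp = span (λ v → ¬? (v ≟ n)) π
      α  = proj₁ sp
      a  = length α
      β  = map (λ v → v ∸ a) (drop 1 (proj₂ sp))
      b  = length β
  in map (λ v → v + b) (Pf f α) ++ (n ∷ Pf f β)

P : List ℕ → List ℕ
P π = Pf (length π) π

-- λ_π, defined by P(π) = λ_π ∘ π, i.e. λ_π(x) = P(π)(π⁻¹(x)).
lam : List ℕ → ℕ → ℕ
lam π x = at (P π) (indexOf x π)

StrictlyBetween : ℕ → ℕ → ℕ → Set
StrictlyBetween p q k = (p < k × k < q) ⊎ (q < k × k < p)

-- Write a 231-avoiding π of [n] as α n γ, where γ = β + |α|.  Avoidance forces every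
-- entry of α below every entry of γ, and P(π) = (P(α) + |β|) n P(β).  For a pair x < y
-- with nothing above y between them, both lie in α (use induction), both lie in γ
-- (induction on β), or y = n, whose image n is the largest value.  The remaining
-- configurations are impossible: x ∈ γ and y ∈ α contradicts α < γ, and x ∈ α, y ∈ γ
-- puts n between them.
module Submission where

open import Defs
open import Data.Nat using (ℕ; zero; suc; _+_; _∸_; _<_; _≤_; _≟_; _≤?_; z≤n; s≤s)
open import Data.Nat.Properties
open import Data.List using (List; []; _∷_; _++_; map; length; upTo; span; [_])
open import Data.List.Properties
  using ( length-++; length-map; map-++; ++-assoc; ++-identityʳ; map-∘; map-cong; map-id
        ; upTo-∷ʳ; length-upTo)
open import Data.List.Relation.Unary.All as All using (All; []; _∷_)
import Data.List.Relation.Unary.All.Properties as All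
open import Data.List.Relation.Unary.Any using (here; there)
open import Data.List.Relation.Unary.Unique.Propositional using (Unique)
open import Data.List.Relation.Unary.AllPairs using (_∷_)
import Data.List.Relation.Unary.Unique.Propositional.Properties as Unique
open import Data.List.Membership.Propositional using (_∈_)
open import Data.List.Membership.Propositional.Properties
  using (∈-++⁻; ∈-++⁺ˡ; ∈-++⁺ʳ; ∈-map⁻; ∈-map⁺; ∈-∃++; ∈-upTo⁺; ∈-upTo⁻)
open import Data.List.Relation.Binary.Permutation.Propositional
  using (_↭_; ↭-sym; ↭-reflexive; prep; ↭⇒↭ₛ; module PermutationReasoning)
open import Data.List.Relation.Binary.Permutation.Propositional.Properties
  using (↭-length; ∈-resp-↭; drop-mid; shift; ∷↭∷ʳ; map⁺)
open import Data.Product using (∃; ∃₂; _×_; _,_; proj₁; proj₂)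
open import Data.Sum using (_⊎_; inj₁; inj₂)
open import Data.Empty using (⊥-elim)
open import Relation.Nullary using (¬_; yes; no)
open import Relation.Nullary.Decidable using (¬?; dec-true; dec-false)
open import Relation.Binary.PropositionalEquality hiding ([_])
open import Data.List.Relation.Binary.Permutation.Setoid.Properties (setoid ℕ) using (Unique-resp-↭)
open import Function.Base using (_∘_)

at-++ˡ : ∀ xs ys {i} → i < length xs → at (xs ++ ys) i ≡ at xs i
at-++ˡ (x ∷ xs) ys {zero}  _       = refl
at-++ˡ (x ∷ xs) ys {suc i} (s≤s i<) = at-++ˡ xs ys i<

at-++ʳ : ∀ xs ys j → at (xs ++ ys) (length xs + j) ≡ at ys j
at-++ʳ []       ys j = refl
at-++ʳ (x ∷ xs) ys j = at-++ʳ xs ys j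

at-map : ∀ (f : ℕ → ℕ) xs {i} → i < length xs → at (map f xs) i ≡ f (at xs i)
at-map f (x ∷ xs) {zero}  _       = refl
at-map f (x ∷ xs) {suc i} (s≤s i<) = at-map f xs i<

at-∈ : ∀ xs {i} → i < length xs → at xs i ∈ xs
at-∈ (x ∷ xs) {zero}  _       = here refl
at-∈ (x ∷ xs) {suc i} (s≤s i<) = there (at-∈ xs i<)

∈⇒at : ∀ {u} xs → u ∈ xs → ∃ λ i → i < length xs × at xs i ≡ u
∈⇒at (x ∷ xs) (here refl) = 0 , s≤s z≤n , refl
∈⇒at (x ∷ xs) (there u∈) with i , i< , eq ← ∈⇒at xs u∈ = suc i , s≤s i< , eq

-- Out of range `at` returns 0, hence the side condition P 0.
All⇒at : ∀ {P : ℕ → Set} xs i → All P xs → P 0 → P (at xs i)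
All⇒at []       i       []         p0 = p0
All⇒at (x ∷ xs) zero    (px ∷ _)   _  = px
All⇒at (x ∷ xs) (suc i) (_ ∷ pxs)  p0 = All⇒at xs i pxs p0

indexOf-≡ : ∀ {x v} xs → x ≡ v → indexOf x (v ∷ xs) ≡ 0
indexOf-≡ {x} {v} xs x≡v rewrite dec-true (x ≟ v) x≡v = refl

indexOf-≢ : ∀ {x v} xs → x ≢ v → indexOf x (v ∷ xs) ≡ suc (indexOf x xs)
indexOf-≢ {x} {v} xs x≢v rewrite dec-false (x ≟ v) x≢v = refl

indexOf<length : ∀ {x} xs → x ∈ xs → indexOf x xs < length xs
indexOf<length {x} (v ∷ xs) x∈ with x ≟ v
... | yes x≡v rewrite indexOf-≡ xs x≡v = s≤s z≤n
indexOf<length {x} (v ∷ xs) (here x≡v) | no x≢v = ⊥-elim (x≢v x≡v)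
indexOf<length {x} (v ∷ xs) (there x∈) | no x≢v
  rewrite indexOf-≢ xs x≢v = s≤s (indexOf<length xs x∈)

indexOf-++ˡ : ∀ {x} xs ys → x ∈ xs → indexOf x (xs ++ ys) ≡ indexOf x xs
indexOf-++ˡ {x} (v ∷ xs) ys x∈ with x ≟ v
... | yes x≡v rewrite indexOf-≡ xs x≡v | indexOf-≡ (xs ++ ys) x≡v = refl
indexOf-++ˡ {x} (v ∷ xs) ys (here x≡v) | no x≢v = ⊥-elim (x≢v x≡v)
indexOf-++ˡ {x} (v ∷ xs) ys (there x∈) | no x≢v
  rewrite indexOf-≢ xs x≢v | indexOf-≢ (xs ++ ys) x≢v = cong suc (indexOf-++ˡ xs ys x∈)

indexOf-++ʳ : ∀ {x} xs ys → All (x ≢_) xs → indexOf x (xs ++ ys) ≡ length xs + indexOf x ys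
indexOf-++ʳ []       ys []          = refl
indexOf-++ʳ (v ∷ xs) ys (x≢v ∷ x∉)
  rewrite indexOf-≢ (xs ++ ys) x≢v = cong suc (indexOf-++ʳ xs ys x∉)

indexOf-map : ∀ (f : ℕ → ℕ) x xs → (∀ {v} → v ∈ xs → f x ≡ f v → x ≡ v) →
              indexOf (f x) (map f xs) ≡ indexOf x xs
indexOf-map f x []       inj = refl
indexOf-map f x (v ∷ xs) inj with x ≟ v
... | yes x≡v rewrite indexOf-≡ xs x≡v | indexOf-≡ (map f xs) (cong f x≡v) = refl
... | no x≢v rewrite indexOf-≢ xs x≢v | indexOf-≢ (map f xs) (x≢v ∘ inj (here refl)) =
  cong suc (indexOf-map f x xs (inj ∘ there))

between-< : ∀ {i j k c} → StrictlyBetween i j k → i < c → j < c → k < c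
between-< (inj₁ (_ , k<j)) _   j<c = <-trans k<j j<c
between-< (inj₂ (_ , k<i)) i<c _   = <-trans k<i i<c

between-+ : ∀ c {i j k} → StrictlyBetween i j k → StrictlyBetween (c + i) (c + j) (c + k)
between-+ c (inj₁ (i<k , k<j)) = inj₁ (+-monoʳ-< c i<k , +-monoʳ-< c k<j)
between-+ c (inj₂ (j<k , k<i)) = inj₂ (+-monoʳ-< c j<k , +-monoʳ-< c k<i)

oneTo-suc : ∀ n → oneTo (suc n) ≡ oneTo n ++ [ suc n ]
oneTo-suc n = trans (cong (map suc) (sym (upTo-∷ʳ n))) (map-++ suc (upTo n) [ n ])

∈-oneTo⁻ : ∀ {u} n → u ∈ oneTo n → 1 ≤ u × u ≤ n
∈-oneTo⁻ n u∈ with w , w∈ , refl ← ∈-map⁻ suc u∈ = s≤s z≤n , ∈-upTo⁻ w∈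

∈-oneTo⁺ : ∀ {u} n → 1 ≤ u → u ≤ n → u ∈ oneTo n
∈-oneTo⁺ {suc w} n _ w<n = ∈-map⁺ suc (∈-upTo⁺ w<n)

length-↭oneTo : ∀ {σ n} → σ ↭ oneTo n → length σ ≡ n
length-↭oneTo {n = n} σ↭ =
  trans (↭-length σ↭) (trans (length-map suc (upTo n)) (length-upTo n))

∈-shifted⁻ : ∀ {v} a b → v ∈ map (_+ a) (oneTo b) → a < v × v ≤ b + a
∈-shifted⁻ a b v∈ with w , w∈ , refl ← ∈-map⁻ (_+ a) v∈
  with 1≤w , w≤b ← ∈-oneTo⁻ b w∈ = +-monoˡ-≤ a 1≤w , +-monoˡ-≤ a w≤b

∈-shifted⁺ : ∀ {v} a b → a < v → v ≤ b + a → v ∈ map (_+ a) (oneTo b)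
∈-shifted⁺ {v} a b a<v v≤ = subst (_∈ _) (m∸n+n≡m (<⇒≤ a<v))
  (∈-map⁺ (_+ a) (∈-oneTo⁺ b (m<n⇒0<n∸m a<v) v∸a≤b))
  where
  v∸a≤b : v ∸ a ≤ b
  v∸a≤b = subst (v ∸ a ≤_) (m+n∸n≡m b a) (∸-monoˡ-≤ a v≤)

unique-↭oneTo : ∀ {σ n} → σ ↭ oneTo n → Unique σ
unique-↭oneTo {n = n} σ↭ =
  Unique-resp-↭ (↭⇒↭ₛ (↭-sym σ↭)) (Unique.map⁺ suc-injective (Unique.upTo⁺ n))

unique-++⇒≢ : ∀ (xs : List ℕ) {ys u v} → Unique (xs ++ ys) → u ∈ xs → v ∈ ys → u ≢ v
unique-++⇒≢ (x ∷ xs) (x≢ ∷ _) (here refl) v∈ = All.lookup (All.++⁻ʳ xs x≢) v∈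
unique-++⇒≢ (x ∷ xs) (_ ∷ u) (there u∈) v∈ = unique-++⇒≢ xs u u∈ v∈

↭-unshift : ∀ a {γ} b → γ ↭ map (_+ a) (oneTo b) → map (_∸ a) γ ↭ oneTo b
↭-unshift a b γ↭ = subst (map (_∸ a) _ ↭_) unshift (map⁺ (_∸ a) γ↭)
  where
  unshift : map (_∸ a) (map (_+ a) (oneTo b)) ≡ oneTo b
  unshift = trans (sym (map-∘ (oneTo b)))
    (trans (map-cong (λ v → m+n∸n≡m v a) (oneTo b)) (map-id (oneTo b)))

length-suffix : ∀ b xs {ys} → xs ++ ys ↭ oneTo (b + length xs) → length ys ≡ b
length-suffix b xs {ys} p = +-cancelʳ-≡ (length xs) (length ys) b
  (trans (+-comm (length ys) (length xs)) (trans (sym (length-++ xs)) (length-↭oneTo p)))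

-- Induction on b: the largest value cannot lie in xs, as it would exceed the entries of the nonempty ys.
↭-split : ∀ b {xs ys} → xs ++ ys ↭ oneTo (b + length xs) →
          (∀ {u v} → u ∈ xs → v ∈ ys → u < v) →
          xs ↭ oneTo (length xs) × ys ↭ map (_+ length xs) (oneTo b)
↭-split zero {xs} {[]} p _ = subst (_↭ oneTo (length xs)) (++-identityʳ xs) p , ↭-reflexive refl
↭-split zero {xs} {_ ∷ _} p _ with () ← length-suffix zero xs p
↭-split (suc b) {xs} {ys} p xs<ys
  with ∈-++⁻ xs (∈-resp-↭ (↭-sym p) (∈-oneTo⁺ (suc b + length xs) (s≤s z≤n) ≤-refl))
... | inj₁ top∈xs =
  ⊥-elim (<⇒≱ (xs<ys top∈xs first∈ys) (proj₂ (∈-oneTo⁻ _ (∈-resp-↭ p (∈-++⁺ʳ xs first∈ys)))))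
  where
  first∈ys : at ys 0 ∈ ys
  first∈ys = at-∈ ys (subst (0 <_) (sym (length-suffix (suc b) xs p)) (s≤s z≤n))
... | inj₂ top∈ys with ys₁ , ys₂ , refl ← ∈-∃++ top∈ys = proj₁ rest , (begin
  ys₁ ++ [ top ] ++ ys₂             ↭⟨ shift top ys₁ ys₂ ⟩
  top ∷ ys₁ ++ ys₂                  ↭⟨ prep top (proj₂ rest) ⟩
  top ∷ map (_+ a) (oneTo b)        ↭⟨ ∷↭∷ʳ top _ ⟩
  map (_+ a) (oneTo b) ++ [ top ]   ≡⟨ map-++ (_+ a) (oneTo b) [ suc b ] ⟨
  map (_+ a) (oneTo b ++ [ suc b ]) ≡⟨ cong (map (_+ a)) (oneTo-suc b) ⟨
  map (_+ a) (oneTo (suc b))        ∎)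
  where
  open PermutationReasoning
  a top : ℕ
  a = length xs
  top = suc (b + a)
  without-top : xs ++ ys₁ ++ ys₂ ↭ oneTo (b + a)
  without-top = subst₂ _↭_ (++-assoc xs ys₁ ys₂) (++-identityʳ (oneTo (b + a)))
    (drop-mid (xs ++ ys₁) (oneTo (b + a))
      (subst₂ _↭_ (sym (++-assoc xs ys₁ _)) (oneTo-suc (b + a)) p))
  rest : xs ↭ oneTo a × ys₁ ++ ys₂ ↭ map (_+ a) (oneTo b)
  rest = ↭-split b without-top
    (λ u∈ v∈ → xs<ys u∈ (∈-resp-↭ (↭-sym (shift top ys₁ ys₂)) (there v∈)))

avoids-++ˡ : ∀ xs {ys} → Avoids231 (xs ++ ys) → Avoids231 xs
avoids-++ˡ xs {ys} av (i , j , k , i<j , j<k , k< , πk<πi , πi<πj) =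
  av (i , j , k , i<j , j<k , k<′ ,
      subst₂ _<_ (at-xs k<) (at-xs i<) πk<πi , subst₂ _<_ (at-xs i<) (at-xs j<) πi<πj)
  where
  j< : j < length xs
  j< = <-trans j<k k<
  i< : i < length xs
  i< = <-trans i<j j<
  at-xs : ∀ {t} → t < length xs → at xs t ≡ at (xs ++ ys) t
  at-xs t< = sym (at-++ˡ xs ys t<)
  k<′ : k < length (xs ++ ys)
  k<′ = subst (k <_) (sym (length-++ xs)) (≤-trans k< (m≤m+n (length xs) (length ys)))

avoids-++ʳ : ∀ xs {ys} → Avoids231 (xs ++ ys) → Avoids231 ys
avoids-++ʳ xs {ys} av (i , j , k , i<j , j<k , k< , πk<πi , πi<πj) =
  av (c + i , c + j , c + k , +-monoʳ-< c i<j , +-monoʳ-< c j<k , k<′ ,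
      subst₂ _<_ (at-ys k) (at-ys i) πk<πi , subst₂ _<_ (at-ys i) (at-ys j) πi<πj)
  where
  c : ℕ
  c = length xs
  at-ys : ∀ t → at ys t ≡ at (xs ++ ys) (c + t)
  at-ys t = sym (at-++ʳ xs ys t)
  k<′ : c + k < length (xs ++ ys)
  k<′ = subst (c + k <_) (sym (length-++ xs)) (+-monoʳ-< c k<)

avoids-map : ∀ (f : ℕ → ℕ) {xs} → (∀ {u v} → u ∈ xs → v ∈ xs → f u < f v → u < v) →
             Avoids231 xs → Avoids231 (map f xs)
avoids-map f {xs} reflects av (i , j , k , i<j , j<k , k<′ , πk<πi , πi<πj) =
  av (i , j , k , i<j , j<k , k< , reflects′ k< i< πk<πi , reflects′ i< j< πi<πj)
  where
  k< : k < length xs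
  k< = subst (k <_) (length-map f xs) k<′
  j< : j < length xs
  j< = <-trans j<k k<
  i< : i < length xs
  i< = <-trans i<j j<
  reflects′ : ∀ {s t} → s < length xs → t < length xs →
              at (map f xs) s < at (map f xs) t → at xs s < at xs t
  reflects′ s< t< fs<ft =
    reflects (at-∈ xs s<) (at-∈ xs t<) (subst₂ _<_ (at-map f xs s<) (at-map f xs t<) fs<ft)

avoids-across : ∀ xs {z ys u v} → Avoids231 (xs ++ z ∷ ys) → u ∈ xs → v ∈ ys → u < z → ¬ v < u
avoids-across xs {z} {ys} av u∈ v∈ u<z v<u
  with i , i< , refl ← ∈⇒at xs u∈ | k , k< , refl ← ∈⇒at ys v∈ =
  av (i , c + 0 , c + suc k , subst (i <_) (sym (+-identityʳ c)) i< , +-monoʳ-< c (s≤s z≤n) ,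
      subst (c + suc k <_) (sym (length-++ xs)) (+-monoʳ-< c (s≤s k<)) ,
      subst₂ _<_ (sym (at-++ʳ xs (z ∷ ys) (suc k))) at-i v<u ,
      subst₂ _<_ at-i (sym (at-++ʳ xs (z ∷ ys) 0)) u<z)
  where
  c : ℕ
  c = length xs
  at-i : at xs i ≡ at (xs ++ z ∷ ys) i
  at-i = sym (at-++ˡ xs (z ∷ ys) i<)

span-≢ : ∀ n σ → n ∈ σ →
         ∃₂ λ α γ → span (λ v → ¬? (v ≟ n)) σ ≡ (α , n ∷ γ) × σ ≡ α ++ n ∷ γ
span-≢ n (v ∷ vs) n∈ with v ≟ n
... | yes refl rewrite dec-false (¬? (v ≟ v)) (λ v≢v → v≢v refl) = [] , vs , refl , refl
span-≢ n (v ∷ vs) (here refl) | no v≢n = ⊥-elim (v≢n refl)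
span-≢ n (v ∷ vs) (there n∈)  | no v≢n rewrite dec-true (¬? (v ≟ n)) v≢n
  with α , γ , span≡ , refl ← span-≢ n vs n∈ rewrite span≡ = v ∷ α , γ , refl , refl

-- π = α ⊕ (1 ⊖ β) with β = γ − |α|, read off at the maximum n = suc m.
record Decomposition (m : ℕ) (σ : List ℕ) : Set where
  field
    α γ      : List ℕ
    span≡    : span (λ v → ¬? (v ≟ suc m)) σ ≡ (α , suc m ∷ γ)
    σ≡       : σ ≡ α ++ suc m ∷ γ
    sizes    : length γ + length α ≡ m
    α↭       : α ↭ oneTo (length α)
    γ↭       : γ ↭ map (_+ length α) (oneTo (length γ))
    α-avoids : Avoids231 α
    β-avoids : Avoids231 (map (_∸ length α) γ)

decompose : ∀ {m σ} → σ ↭ oneTo (suc m) → Avoids231 σ → Decomposition m σ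
decompose {m} {σ} σ↭ av
  with α , γ , span≡ , refl ← span-≢ (suc m) σ (∈-resp-↭ (↭-sym σ↭) (∈-oneTo⁺ (suc m) (s≤s z≤n) ≤-refl)) =
  record { α = α ; γ = γ ; span≡ = span≡ ; σ≡ = refl ; sizes = sizes
         ; α↭ = proj₁ split ; γ↭ = proj₂ split
         ; α-avoids = avoids-++ˡ α av
         ; β-avoids = avoids-map (_∸ length α) ∸-reflects (avoids-++ʳ [ suc m ] (avoids-++ʳ α av))
         }
  where
  rest↭ : α ++ γ ↭ oneTo m
  rest↭ = subst (α ++ γ ↭_) (++-identityʳ (oneTo m))
    (drop-mid α (oneTo m) (subst (σ ↭_) (oneTo-suc m) σ↭))
  sizes : length γ + length α ≡ m
  sizes = trans (+-comm (length γ) (length α)) (trans (sym (length-++ α)) (length-↭oneTo rest↭))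
  α<γ : ∀ {u v} → u ∈ α → v ∈ γ → u < v
  α<γ u∈ v∈ = ≤∧≢⇒<
    (≮⇒≥ (avoids-across α av u∈ v∈ (s≤s (proj₂ (∈-oneTo⁻ m (∈-resp-↭ rest↭ (∈-++⁺ˡ u∈)))))))
    (unique-++⇒≢ α (unique-↭oneTo σ↭) u∈ (there v∈))
  split : α ↭ oneTo (length α) × γ ↭ map (_+ length α) (oneTo (length γ))
  split = ↭-split (length γ) (subst (λ k → α ++ γ ↭ oneTo k) (sym sizes) rest↭) α<γ
  above-α : ∀ {v} → v ∈ γ → length α < v
  above-α v∈ = proj₁ (∈-shifted⁻ (length α) (length γ) (∈-resp-↭ (proj₂ split) v∈))
  ∸-reflects : ∀ {u v} → u ∈ γ → v ∈ γ → u ∸ length α < v ∸ length α → u < v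
  ∸-reflects u∈ v∈ u′<v′ =
    subst₂ _<_ (m∸n+n≡m (<⇒≤ (above-α u∈))) (m∸n+n≡m (<⇒≤ (above-α v∈)))
    (+-monoˡ-< (length α) u′<v′)

Clear : List ℕ → ℕ → ℕ → Set
Clear σ x y = ∀ k → StrictlyBetween (indexOf x σ) (indexOf y σ) k → at σ k ≤ y

-- The length locates the blocks of P(σ) = (P(α) + |β|) n P(β); the bound makes n its largest entry.
record Respects (m : ℕ) (σ L : List ℕ) : Set where
  field
    length≡ : length L ≡ m
    bounded : All (_≤ m) L
    clear⇒< : ∀ x y → 1 ≤ x → x < y → y ≤ m → Clear σ x y →
              at L (indexOf x σ) < at L (indexOf y σ)

respects-[] : Respects 0 [] []
respects-[] = record
  { length≡ = refl
  ; bounded = []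
  ; clear⇒< = λ _ _ _ x<y y≤0 _ → ⊥-elim (<⇒≱ x<y (≤-trans y≤0 z≤n))
  }

module Split {m : ℕ} {α γ Lα Lβ : List ℕ} (sizes : length γ + length α ≡ m)
  (α↭ : α ↭ oneTo (length α)) (γ↭ : γ ↭ map (_+ length α) (oneTo (length γ)))
  (Rα : Respects (length α) α Lα) (Rβ : Respects (length γ) (map (_∸ length α) γ) Lβ) where

  a b : ℕ
  a = length α
  b = length γ

  β σ L : List ℕ
  β = map (_∸ a) γ
  σ = α ++ suc m ∷ γ
  L = map (_+ b) Lα ++ suc m ∷ Lβ

  module Rα = Respects Rα
  module Rβ = Respects Rβ

  a+b≤m : a + b ≤ m
  a+b≤m = ≤-reflexive (trans (+-comm a b) sizes)

  b≤m : b ≤ m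
  b≤m = subst (b ≤_) sizes (m≤m+n b a)

  α-bound : ∀ {u} → u ∈ α → u ≤ a
  α-bound u∈ = proj₂ (∈-oneTo⁻ a (∈-resp-↭ α↭ u∈))

  γ-range : ∀ {v} → v ∈ γ → a < v × v ≤ b + a
  γ-range v∈ = ∈-shifted⁻ a b (∈-resp-↭ γ↭ v∈)

  γ-below-top : ∀ {v} → v ∈ γ → v < suc m
  γ-below-top v∈ = s≤s (≤-trans (proj₂ (γ-range v∈)) (≤-reflexive sizes))

  locate : ∀ {u} → 1 ≤ u → u ≤ suc m → u ∈ α ⊎ u ≡ suc m ⊎ u ∈ γ
  locate {u} 1≤u u≤ with u ≤? a | m≤n⇒m<n∨m≡n u≤
  ... | yes u≤a | _             = inj₁ (∈-resp-↭ (↭-sym α↭) (∈-oneTo⁺ a 1≤u u≤a))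
  ... | no _    | inj₂ u≡top    = inj₂ (inj₁ u≡top)
  ... | no u≰a  | inj₁ (s≤s u≤m) =
    inj₂ (inj₂ (∈-resp-↭ (↭-sym γ↭) (∈-shifted⁺ a b (≰⇒> u≰a) (subst (u ≤_) (sym sizes) u≤m))))

  above-∉α : ∀ {u} → a < u → All (u ≢_) α
  above-∉α a<u = All.tabulate λ v∈ u≡v → <⇒≱ a<u (subst (_≤ a) (sym u≡v) (α-bound v∈))

  indexOf-α : ∀ {u} → u ∈ α → indexOf u σ ≡ indexOf u α
  indexOf-α = indexOf-++ˡ α (suc m ∷ γ)

  indexOf-top : indexOf (suc m) σ ≡ a + 0
  indexOf-top = trans (indexOf-++ʳ α _ (above-∉α (s≤s (≤-trans (m≤m+n a b) a+b≤m))))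
                      (cong (a +_) (indexOf-≡ γ refl))

  indexOf-γ : ∀ {v} → v ∈ γ → indexOf v σ ≡ a + suc (indexOf v γ)
  indexOf-γ v∈ = trans (indexOf-++ʳ α _ (above-∉α (proj₁ (γ-range v∈))))
                       (cong (a +_) (indexOf-≢ γ (<⇒≢ (γ-below-top v∈))))

  indexOf-β : ∀ {v} → v ∈ γ → indexOf (v ∸ a) β ≡ indexOf v γ
  indexOf-β {v} v∈ = indexOf-map (_∸ a) v γ
    (λ w∈ → ∸-cancelʳ-≡ (<⇒≤ (proj₁ (γ-range v∈))) (<⇒≤ (proj₁ (γ-range w∈))))

  length-shifted : length (map (_+ b) Lα) ≡ a
  length-shifted = trans (length-map (_+ b) Lα) Rα.length≡

  L-at-α : ∀ {u} → u ∈ α → at L (indexOf u σ) ≡ at Lα (indexOf u α) + b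
  L-at-α {u} u∈ = begin
    at L (indexOf u σ)   ≡⟨ cong (at L) (indexOf-α u∈) ⟩
    at L i               ≡⟨ at-++ˡ (map (_+ b) Lα) _ (subst (i <_) (sym length-shifted) i<a) ⟩
    at (map (_+ b) Lα) i ≡⟨ at-map (_+ b) Lα (subst (i <_) (sym Rα.length≡) i<a) ⟩
    at Lα i + b          ∎
    where
    open ≡-Reasoning
    i : ℕ
    i = indexOf u α
    i<a : i < a
    i<a = indexOf<length α u∈

  L-at-right : ∀ j → at L (a + j) ≡ at (suc m ∷ Lβ) j
  L-at-right j = subst (λ c → at L (c + j) ≡ at (suc m ∷ Lβ) j) length-shifted
    (at-++ʳ (map (_+ b) Lα) _ j)

  L-at-top : at L (indexOf (suc m) σ) ≡ suc m
  L-at-top = trans (cong (at L) indexOf-top) (L-at-right 0)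

  L-at-γ : ∀ {v} → v ∈ γ → at L (indexOf v σ) ≡ at Lβ (indexOf (v ∸ a) β)
  L-at-γ v∈ =
    trans (cong (at L) (indexOf-γ v∈)) (trans (L-at-right _) (cong (at Lβ) (sym (indexOf-β v∈))))

  clear-α : ∀ {x y} → x ∈ α → y ∈ α → Clear σ x y → Clear α x y
  clear-α {x} {y} x∈ y∈ clear k btw-α = subst (_≤ y) (at-++ˡ α _ k<a) (clear k btw-σ)
    where
    k<a : k < a
    k<a = between-< btw-α (indexOf<length α x∈) (indexOf<length α y∈)
    btw-σ : StrictlyBetween (indexOf x σ) (indexOf y σ) k
    btw-σ = subst₂ (λ i j → StrictlyBetween i j k) (sym (indexOf-α x∈)) (sym (indexOf-α y∈)) btw-α

  clear-β : ∀ {x y} → x ∈ γ → y ∈ γ → Clear σ x y → Clear β (x ∸ a) (y ∸ a)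
  clear-β {x} {y} x∈ y∈ clear k btw-β =
    subst (_≤ y ∸ a) (sym (at-map (_∸ a) γ k<b))
      (∸-monoˡ-≤ a (subst (_≤ y) (at-++ʳ α _ (suc k)) (clear _ btw-σ)))
    where
    btw-γ : StrictlyBetween (indexOf x γ) (indexOf y γ) k
    btw-γ = subst₂ (λ i j → StrictlyBetween i j k) (indexOf-β x∈) (indexOf-β y∈) btw-β
    k<b : k < b
    k<b = between-< btw-γ (indexOf<length γ x∈) (indexOf<length γ y∈)
    btw-σ : StrictlyBetween (indexOf x σ) (indexOf y σ) (a + suc k)
    btw-σ = subst₂ (λ i j → StrictlyBetween i j (a + suc k)) (sym (indexOf-γ x∈)) (sym (indexOf-γ y∈))
                   (between-+ a (between-+ 1 btw-γ))

  top-between : ∀ {x y} → x ∈ α → y ∈ γ → StrictlyBetween (indexOf x σ) (indexOf y σ) (a + 0)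
  top-between x∈ y∈ = inj₁
    ( subst₂ _<_ (sym (indexOf-α x∈)) (sym (+-identityʳ a)) (indexOf<length α x∈)
    , subst (a + 0 <_) (sym (indexOf-γ y∈)) (+-monoʳ-< a (s≤s z≤n)))

  <-within-α : ∀ {x y} → x ∈ α → y ∈ α → 1 ≤ x → x < y → Clear σ x y →
               at L (indexOf x σ) < at L (indexOf y σ)
  <-within-α x∈ y∈ 1≤x x<y clear = subst₂ _<_ (sym (L-at-α x∈)) (sym (L-at-α y∈))
    (+-monoˡ-< b (Rα.clear⇒< _ _ 1≤x x<y (α-bound y∈) (clear-α x∈ y∈ clear)))

  <-within-γ : ∀ {x y} → x ∈ γ → y ∈ γ → x < y → Clear σ x y →
               at L (indexOf x σ) < at L (indexOf y σ)
  <-within-γ {x} {y} x∈ y∈ x<y clear = subst₂ _<_ (sym (L-at-γ x∈)) (sym (L-at-γ y∈))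
    (Rβ.clear⇒< (x ∸ a) (y ∸ a) (m<n⇒0<n∸m a<x) (∸-monoˡ-< x<y (<⇒≤ a<x))
                (subst (y ∸ a ≤_) (m+n∸n≡m b a) (∸-monoˡ-≤ a (proj₂ (γ-range y∈))))
                (clear-β x∈ y∈ clear))
    where
    a<x : a < x
    a<x = proj₁ (γ-range x∈)

  <-top-α : ∀ {x} → x ∈ α → at L (indexOf x σ) < at L (indexOf (suc m) σ)
  <-top-α x∈ = subst₂ _<_ (sym (L-at-α x∈)) (sym L-at-top)
    (s≤s (≤-trans (+-monoˡ-≤ b (All⇒at Lα _ Rα.bounded z≤n)) a+b≤m))

  <-top-γ : ∀ {x} → x ∈ γ → at L (indexOf x σ) < at L (indexOf (suc m) σ)
  <-top-γ x∈ = subst₂ _<_ (sym (L-at-γ x∈)) (sym L-at-top)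
    (s≤s (≤-trans (All⇒at Lβ _ Rβ.bounded z≤n) b≤m))

  clear⇒< : ∀ x y → 1 ≤ x → x < y → y ≤ suc m → Clear σ x y →
            at L (indexOf x σ) < at L (indexOf y σ)
  clear⇒< x y 1≤x x<y y≤ clear
    with locate 1≤x (≤-trans (<⇒≤ x<y) y≤) | locate (≤-trans 1≤x (<⇒≤ x<y)) y≤
  ... | inj₂ (inj₁ refl) | _                = ⊥-elim (<⇒≱ x<y y≤)
  ... | inj₁ x∈         | inj₁ y∈          = <-within-α x∈ y∈ 1≤x x<y clear
  ... | inj₁ x∈         | inj₂ (inj₁ refl) = <-top-α x∈
  ... | inj₁ x∈         | inj₂ (inj₂ y∈)   =
    ⊥-elim (<⇒≱ (γ-below-top y∈) (subst (_≤ y) (at-++ʳ α _ 0) (clear _ (top-between x∈ y∈))))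
  ... | inj₂ (inj₂ x∈)  | inj₁ y∈          =
    ⊥-elim (<⇒≱ (<-trans (proj₁ (γ-range x∈)) x<y) (α-bound y∈))
  ... | inj₂ (inj₂ x∈)  | inj₂ (inj₁ refl) = <-top-γ x∈
  ... | inj₂ (inj₂ x∈)  | inj₂ (inj₂ y∈)   = <-within-γ x∈ y∈ x<y clear

  respects : Respects (suc m) σ L
  respects = record
    { length≡ = trans (length-++ (map (_+ b) Lα))
                  (trans (cong₂ (λ i j → i + suc j) length-shifted Rβ.length≡)
                    (trans (+-suc a b) (cong suc (trans (+-comm a b) sizes))))
    ; bounded = All.++⁺
        (All.map⁺ (All.map (λ p≤a → m≤n⇒m≤1+n (≤-trans (+-monoˡ-≤ b p≤a) a+b≤m)) Rα.bounded))
        (≤-refl ∷ All.map (λ p≤b → m≤n⇒m≤1+n (≤-trans p≤b b≤m)) Rβ.bounded)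
    ; clear⇒< = clear⇒<
    }

Pf-[] : ∀ f → Pf f [] ≡ []
Pf-[] zero    = refl
Pf-[] (suc f) = refl

Pf-step : ∀ f {m σ} → length σ ≡ suc m → (D : Decomposition m σ) → let open Decomposition D in
          Pf (suc f) σ ≡ map (_+ length γ) (Pf f α) ++ suc m ∷ Pf f (map (_∸ length α) γ)
Pf-step f {σ = v ∷ vs} refl D
  rewrite Decomposition.span≡ D
        | length-map (_∸ length (Decomposition.α D)) (Decomposition.γ D) = refl

Pf-respects : ∀ f {m σ} → σ ↭ oneTo m → Avoids231 σ → m ≤ f → Respects m σ (Pf f σ)
Pf-respects f {zero} {[]} _ _ _ rewrite Pf-[] f = respects-[]
Pf-respects f {zero} {_ ∷ _} σ↭ _ _ with () ← length-↭oneTo σ↭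
Pf-respects (suc f) {suc m} {σ} σ↭ av (s≤s m≤f) =
  subst₂ (Respects (suc m)) (sym σ≡) (sym (Pf-step f (length-↭oneTo σ↭) D))
    (Split.respects sizes α↭ γ↭
      (Pf-respects f α↭ α-avoids (below-fuel (m≤n+m (length α) (length γ))))
      (Pf-respects f (↭-unshift (length α) (length γ) γ↭) β-avoids
        (below-fuel (m≤m+n (length γ) (length α)))))
  where
  D : Decomposition m σ
  D = decompose σ↭ av
  open Decomposition D
  below-fuel : ∀ {k} → k ≤ length γ + length α → k ≤ f
  below-fuel k≤ = ≤-trans k≤ (≤-trans (≤-reflexive sizes) m≤f)

mainTheorem11 : (n : ℕ) (π : List ℕ) → IsPerm n π → Avoids231 π →
    (x y : ℕ) → 1 ≤ x → x < y → y ≤ n →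
    (∀ k → StrictlyBetween (indexOf x π) (indexOf y π) k → at π k ≤ y) →
    lam π x < lam π y
mainTheorem11 n π π↭ av =
  Respects.clear⇒< (Pf-respects (length π) π↭ av (≤-reflexive (sym (length-↭oneTo π↭))))
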